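{- Assume a selection rule. If a program $P$ with a query $Q$ is weakly occur-check free, then algorithm MMA$^-$ is sound for each unification available in the SLD-tree for $P$ with $Q$.
   Context: MMA (Martelli–Montanari algorithm) operates on a finite set of equations by nondeterministically choosing an equation and applying: (1) $f(s_1,\ldots,s_n)\doteq f(t_1,\ldots,t_n)$ → replace by $s_i\doteq t_i$; (2) $f(\ldots)\doteq g(\ldots)$, $f\ne g$ → fail; (3) $X\doteq X$ → delete; (4) $t\doteq X$, $t$ non-variable → replace by $X\doteq t$; (5) $X\doteq t$, $X\notin Var(t)$, $X$ occurring elsewhere → apply $\{X/t\}$ to all other equations; (6) $X\doteq t$, $X\in Var(t)$, $X\ne t$ → fail. An equation set is WNSTO if there exists a run of MMA on it in which action (6) is not performed. MMA$^-$ has actions (1)–(4) and, instead of (5),(6): (5a) $X\doteq Y$, distinct variables, $X$ occurring elsewhere → apply $\{X/Y\}$ to all other equations; (5b) $X\doteq t$, $X\doteq u$ with $t,u$ distinct non-variable terms → with $\{s_1,s_2\}=\{t,u\}$, $|s_1|\le|s_2|$ ($|\cdot|$ = number of symbol and variable occurrences), replace $X\doteq s_2$ by $s_1\doteq s_2$. A run of MMA$^-$ on $E$ is correct if it halts with failure when $E$ is not unifiable and otherwise produces a unifiable equation set in semi-solved form ($\{X_1\doteq t_1,\ldots,X_n\doteq t_n\}$, distinct $X_i$, $X_i\ne t_i$, and $X_i$ occurring once if $t_i$ is a variable); MMA$^-$ is sound for $E$ if all its runs on $E$ are correct. In an SLD-tree for $P$ with $Q$, the unification of $A$ and $H$ (equation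 set $\{A\doteq H\}$) is available if $A$ is the selected atom of a query of the tree and $H$ is a standardized-apart head of a clause of $P$ with the same predicate symbol. $P$ with $Q$ is weakly occur-check free (under the given selection rule) if all unifications available in the SLD-tree for $P$ with $Q$ are WNSTO. -}

module Defs where

open import Data.Nat using (ℕ; zero; suc; _≤_; _+_; _≟_)
open import Data.Bool using (Bool; true; false)
open import Data.List using (List; []; _∷_; length; zip; _++_; take; drop; lookup; [_])
open import Data.List.Membership.Propositional using (_∈_)
open import Data.Fin using (Fin; toℕ)
open import Data.Product using (Σ; _×_; _,_; proj₁; proj₂)
open import Data.Sum using (_⊎_)
open import Data.Unit using (⊤)
open import Data.Empty using (⊥)
open import Relation.Nullary using (¬_; yes; no)
open import Relation.Binary.PropositionalEquality using (_≡_; _≢_)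
open import Relation.Binary.Construct.Closure.ReflexiveTransitive using (Star)
open import Function.Definitions using (Injective)

-- Terms (variables are natural numbers; a function symbol is a name
-- together with its arity, the arity being the length of the argument
-- list).

data Term : Set where
  var : ℕ → Term
  fun : ℕ → List Term → Term

data _occ_ (x : ℕ) : Term → Set where
  here : x occ var x
  arg  : ∀ {f ts t} → t ∈ ts → x occ t → x occ fun f ts

mutual
  size : Term → ℕ
  size (var x)    = 1
  size (fun f ts) = suc (sizes ts)

  sizes : List Term → ℕ
  sizes []       = 0
  sizes (t ∷ ts) = size t + sizes ts

IsVar : Term → Set
IsVar t = Σ ℕ λ x → t ≡ var x

NonVar : Term → Set
NonVar t = ¬ IsVar t

Subst : Set
Subst = ℕ → Term

mutual
  _·_ : Subst → Term → Term
  σ · var x    = σ x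
  σ · fun f ts = fun f (σ ·* ts)

  _·*_ : Subst → List Term → List Term
  σ ·* []       = []
  σ ·* (t ∷ ts) = (σ · t) ∷ (σ ·* ts)

[_↦_] : ℕ → Term → Subst
[ X ↦ t ] y with X ≟ y
... | yes _ = t
... | no  _ = var y

-- Equations and (finite) equation sets.  A finite set of equations is
-- represented by a list; all operations are specified up to the set of
-- members (so duplicates are irrelevant).

Equation : Set
Equation = Term × Term

Eqs : Set
Eqs = List Equation

_·ₑ_ : Subst → Equation → Equation
σ ·ₑ (s , t) = (σ · s , σ · t)

OccEq : ℕ → Equation → Set
OccEq X e = X occ proj₁ e ⊎ X occ proj₂ e

OccursElsewhere : ℕ → Equation → Eqs → Set
OccursElsewhere X e E = Σ Equation λ e' → e' ∈ E × e' ≢ e × OccEq X e'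

infix 3 _⇔_
_⇔_ : Set → Set → Set
A ⇔ B = (A → B) × (B → A)

Replaces : Eqs → Equation → Eqs → Eqs → Set
Replaces E e N E' = ∀ x → x ∈ E' ⇔ ((x ∈ E × x ≢ e) ⊎ x ∈ N)

SubstOthers : Eqs → Equation → Subst → Eqs → Set
SubstOthers E e σ E' =
  ∀ x → x ∈ E' ⇔ (x ≡ e ⊎ Σ Equation λ y → y ∈ E × y ≢ e × x ≡ σ ·ₑ y)

data State : Set where
  eqs  : Eqs → State
  fail : State

-- actions (1)–(4), common to MMA and MMA⁻
data CommonStep (E : Eqs) : State → Set where
  decompose : ∀ {f ss ts E'} → (fun f ss , fun f ts) ∈ E → length ss ≡ length ts →
              Replaces E (fun f ss , fun f ts) (zip ss ts) E' → CommonStep E (eqs E')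
  clash     : ∀ {f g ss ts} → (fun f ss , fun g ts) ∈ E →
              (f ≢ g ⊎ length ss ≢ length ts) → CommonStep E fail
  delete    : ∀ {X E'} → (var X , var X) ∈ E →
              Replaces E (var X , var X) [] E' → CommonStep E (eqs E')
  swap      : ∀ {t X E'} → (t , var X) ∈ E → NonVar t →
              Replaces E (t , var X) [ (var X , t) ] E' → CommonStep E (eqs E')

-- MMA.  The Bool index records whether the step is action (6).

data MMAStep (E : Eqs) : Bool → State → Set where
  common    : ∀ {s} → CommonStep E s → MMAStep E false s
  eliminate : ∀ {X t E'} → (var X , t) ∈ E → ¬ (X occ t) →
              OccursElsewhere X (var X , t) E →
              SubstOthers E (var X , t) [ X ↦ t ] E' → MMAStep E false (eqs E')
  occurFail : ∀ {X t} → (var X , t) ∈ E → X occ t → var X ≢ t → MMAStep E true fail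

data _⟶no6_ : State → State → Set where
  step : ∀ {E s} → MMAStep E false s → eqs E ⟶no6 s

MMAHalted : State → Set
MMAHalted fail    = ⊤
MMAHalted (eqs E) = ∀ b s → ¬ MMAStep E b s

WNSTO : Eqs → Set
WNSTO E = Σ State λ s → Star _⟶no6_ (eqs E) s × MMAHalted s

data MinusStep (E : Eqs) : State → Set where
  common   : ∀ {s} → CommonStep E s → MinusStep E s
  elimVar  : ∀ {X Y E'} → (var X , var Y) ∈ E → X ≢ Y →
             OccursElsewhere X (var X , var Y) E →
             SubstOthers E (var X , var Y) [ X ↦ var Y ] E' → MinusStep E (eqs E')
  -- (5b): X ≐ t, X ≐ u, |t| ≤ |u| : replace X ≐ u by t ≐ u
  merge    : ∀ {X t u E'} → (var X , t) ∈ E → (var X , u) ∈ E → t ≢ u →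
             NonVar t → NonVar u → size t ≤ size u →
             Replaces E (var X , u) [ (t , u) ] E' → MinusStep E (eqs E')

data _⟶⁻_ : State → State → Set where
  step : ∀ {E s} → MinusStep E s → eqs E ⟶⁻ s

MinusHalted : State → Set
MinusHalted fail    = ⊤
MinusHalted (eqs E) = ∀ s → ¬ MinusStep E s

Unifiable : Eqs → Set
Unifiable E = Σ Subst λ θ → ∀ s t → (s , t) ∈ E → θ · s ≡ θ · t

SemiSolved : Eqs → Set
SemiSolved E =
  (∀ e → e ∈ E → Σ ℕ λ X → Σ Term λ t → e ≡ (var X , t) × var X ≢ t) ×
  (∀ X t u → (var X , t) ∈ E → (var X , u) ∈ E → t ≡ u) ×
  (∀ X Y → (var X , var Y) ∈ E → ∀ e → e ∈ E → e ≢ (var X , var Y) → ¬ OccEq X e)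

CorrectOutcome : Eqs → State → Set
CorrectOutcome E s =
  (¬ Unifiable E → s ≡ fail) ×
  (Unifiable E → Σ Eqs λ E' → s ≡ eqs E' × Unifiable E' × SemiSolved E')

MMA⁻Sound : Eqs → Set
MMA⁻Sound E =
  (¬ Σ (ℕ → State) λ f → f 0 ≡ eqs E × (∀ n → f n ⟶⁻ f (suc n))) ×
  (∀ s → Star _⟶⁻_ (eqs E) s → MinusHalted s → CorrectOutcome E s)

record Atom : Set where
  constructor atom
  field
    pred : ℕ
    args : List Term
open Atom public

atomTerm : Atom → Term
atomTerm (atom p ts) = fun p ts

record Clause : Set where
  constructor _:-_
  field
    head : Atom
    body : List Atom
open Clause public

Program : Set
Program = List Clause

Query : Set
Query = List Atom

_·a_ : Subst → Atom → Atom
σ ·a atom p ts = atom p (σ ·* ts)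

_·q_ : Subst → Query → Query
σ ·q []       = []
σ ·q (a ∷ as) = (σ ·a a) ∷ (σ ·q as)

_·c_ : Subst → Clause → Clause
σ ·c (h :- b) = (σ ·a h) :- (σ ·q b)

rename : (ℕ → ℕ) → Clause → Clause
rename ρ c = (λ x → var (ρ x)) ·c c

OccQ : ℕ → Query → Set
OccQ x q = Σ Atom λ a → a ∈ q × x occ atomTerm a

OccC : ℕ → Clause → Set
OccC x c = x occ atomTerm (head c) ⊎ OccQ x (body c)

Unifier : Subst → Term → Term → Set
Unifier θ s t = θ · s ≡ θ · t

MGU : Subst → Term → Term → Set
MGU θ s t = Unifier θ s t ×
  (∀ η → Unifier η s t → Σ Subst λ δ → ∀ x → η x ≡ δ · θ x)

record Entry : Set where
  constructor entry
  field
    query   : Query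
    variant : Clause
    mgu     : Subst

OccH : ℕ → List Entry → Set
OccH x h = Σ Entry λ en → en ∈ h × (OccQ x (Entry.query en) ⊎ OccC x (Entry.variant en))

SelectionRule : Set
SelectionRule = (h : List Entry) (a : Atom) (as : List Atom) → Fin (suc (length as))

selected : SelectionRule → List Entry → Atom → List Atom → Atom
selected R h a as = lookup (a ∷ as) (R h a as)

StandardizedApart : Clause → List Entry → Query → Set
StandardizedApart c' h q = ∀ x → OccC x c' → ¬ OccQ x q × ¬ OccH x h

ApartVariant : Program → List Entry → Query → Clause → Set
ApartVariant P h q c' = Σ Clause λ c → c ∈ P × Σ (ℕ → ℕ) λ ρ →
  Injective _≡_ _≡_ ρ × c' ≡ rename ρ c × StandardizedApart c' h q

-- nodes of the SLD-tree for P with Q under R: a node is the derivation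
-- leading to it (history) together with its query
data Node (P : Program) (R : SelectionRule) (Q : Query) : List Entry → Query → Set where
  root : Node P R Q [] Q
  resolve : ∀ {h a as c' θ} → Node P R Q h (a ∷ as) →
    ApartVariant P h (a ∷ as) c' →
    MGU θ (atomTerm (selected R h a as)) (atomTerm (head c')) →
    Node P R Q (h ++ [ entry (a ∷ as) c' θ ])
      (θ ·q (take (toℕ (R h a as)) (a ∷ as) ++ body c' ++ drop (suc (toℕ (R h a as))) (a ∷ as)))

Available : Program → SelectionRule → Query → Atom → Atom → Set
Available P R Q A H = Σ (List Entry) λ h → Σ Atom λ a → Σ (List Atom) λ as →
  Node P R Q h (a ∷ as) × A ≡ selected R h a as ×
  Σ Clause λ c' → ApartVariant P h (a ∷ as) c' × H ≡ head c' ×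
  pred A ≡ pred H × length (args A) ≡ length (args H)

UnifEqs : Atom → Atom → Eqs
UnifEqs A H = [ (atomTerm A , atomTerm H) ]

WeaklyOccurCheckFree : Program → SelectionRule → Query → Set
WeaklyOccurCheckFree P R Q = ∀ A H → Available P R Q A H → WNSTO (UnifEqs A H)

-- Call X isolated in S if some X ≐ Y with Y ≠ X is the only equation of S in
-- which X occurs.  Action (5a) isolates its variable and keeps isolated variables isolated;
-- every other action of MMA⁻ replaces one equation by finitely many strictly lighter ones,
-- the weight being the size of the larger side refined by the shape of the equation, and
-- leaves isolated variables isolated.  Hence the number of non-isolated variables, followed
-- by the numbers of distinct equations of each weight from the heaviest down, decreases
-- lexicographically.
--
-- Say that θ solves E up to depth n if both sides of every equation agree
-- once truncated at depth n.  Every action other than (6) carries solutions up to depth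
-- n + 1 forward and solutions up to depth n backward, so runs preserve unifiers, and
-- solvability at each depth is preserved in both directions.  A halted MMA⁻ set is
-- semi-solved, and truncating its rational-tree solution solves it at each depth; so E
-- is solvable at each depth.  A run of MMA without (6), which exists when E is WNSTO,
-- therefore cannot fail and halts in solved form, whence E is unifiable.

module Submission where

open import Defs

open import Data.Bool using (true; false)
open import Data.Empty using (⊥; ⊥-elim)
open import Data.List using (List; []; _∷_; [_]; _++_; length; map; zip; filter; concatMap; deduplicate)
open import Data.List.Extrema.Nat using (max; v≤max⁺)
open import Data.List.Membership.Propositional using (_∈_; _∉_; find; lose)
open import Data.List.Membership.Propositional.Properties
  using (∈-filter⁺; ∈-filter⁻; ∈-++⁺ˡ; ∈-++⁺ʳ; ∈-++⁻; ∈-map⁺; ∈-map⁻; ∈-concatMap⁺; ∈-concatMap⁻;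
         ∈-deduplicate⁺; ∈-deduplicate⁻)
open import Data.List.Properties using (∷-dec; ∷-injective; length-map; filter-notAll)
open import Data.List.Relation.Binary.Subset.Propositional using (_⊆_)
open import Data.List.Relation.Unary.All as All using (all?)
open import Data.List.Relation.Unary.AllPairs using ([]; _∷_)
open import Data.List.Relation.Unary.Any as Any using (Any; here; there; any?)
open import Data.List.Relation.Unary.Unique.Propositional using (Unique)
open import Data.List.Relation.Unary.Unique.DecPropositional.Properties using (deduplicate-!)
open import Data.Nat using (ℕ; zero; suc; _+_; _*_; _⊔_; _≤_; _<_; _≟_; _≤?_; z≤n; s≤s)
import Data.Nat.Induction as ℕ
open import Data.List.Membership.DecPropositional _≟_ using (_∈?_)
open import Data.Nat.Properties
  using (module ≤-Reasoning; ≤-refl; ≤-reflexive; ≤-trans; <-trans; <⇒≤; <-irrefl; ≤⇒≯; ≰⇒≥;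
         m≤m+n; m≤n+m; m≤n⇒m<n∨m≡n; m≤n⇒m⊔n≡n; ⊔-identityʳ; ⊔-mono-≤; *-monoʳ-≤; +-monoˡ-<; *-suc;
         <-resp₂-≡; suc-injective)
open import Data.Product using (∃; ∃₂; _×_; _,_; proj₁; proj₂)
open import Data.Product.Properties using (≡-dec)
open import Data.Sum as Sum using (_⊎_; inj₁; inj₂)
open import Data.Vec using (Vec; []; _∷_)
open import Data.Vec.Relation.Binary.Lex.Strict using (Lex-<; this; next; <-wellFounded)
open import Function using (_∘_)
open import Induction.WellFounded using (WellFounded; Acc; acc)
open import Level using (0ℓ)
open import Relation.Binary using (Rel; DecidableEquality)
open import Relation.Binary.Construct.Closure.ReflexiveTransitive using (Star; ε; _◅_)
open import Relation.Binary.PropositionalEquality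
  using (_≡_; _≢_; refl; sym; trans; cong; cong₂; subst; subst₂; module ≡-Reasoning)
open import Relation.Nullary using (¬_; Dec; yes; no; ¬?)
open import Relation.Nullary.Decidable using (map′; _×-dec_; _→-dec_; _⊎-dec_)

-- Lists and lexicographic descent

module _ {A : Set} (_≟_ : DecidableEquality A) where

  Unique-⊆⇒length-≤ : ∀ {xs ys : List A} → Unique xs → xs ⊆ ys → length xs ≤ length ys
  Unique-⊆⇒length-≤ []                   _   = z≤n
  Unique-⊆⇒length-≤ {x ∷ xs} {ys} (x∉xs ∷ u) sub =
    ≤-trans (s≤s (Unique-⊆⇒length-≤ u xs⊆ys-x)) (filter-notAll (¬? ∘ (x ≟_)) ys x∈ys)
    where
      xs⊆ys-x : xs ⊆ filter (¬? ∘ (x ≟_)) ys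
      xs⊆ys-x z∈xs = ∈-filter⁺ (¬? ∘ (x ≟_)) (sub (there z∈xs)) (All.lookup x∉xs z∈xs)
      x∈ys : Any (λ y → ¬ ¬ x ≡ y) ys
      x∈ys = Any.map (λ x≡y x≢y → x≢y x≡y) (sub (here refl))

  countDistinct : List A → ℕ
  countDistinct xs = length (deduplicate _≟_ xs)

  countDistinct-mono : ∀ {xs ys} → xs ⊆ ys → countDistinct xs ≤ countDistinct ys
  countDistinct-mono {xs} sub =
    Unique-⊆⇒length-≤ (deduplicate-! _≟_ xs) (∈-deduplicate⁺ _≟_ ∘ sub ∘ ∈-deduplicate⁻ _≟_ xs)

  countDistinct-< : ∀ {xs ys y} → xs ⊆ ys → y ∈ ys → y ∉ xs → countDistinct xs < countDistinct ys
  countDistinct-< {xs} {ys} {y} sub y∈ys y∉xs =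
    Unique-⊆⇒length-≤ (All.tabulate y≢ ∷ deduplicate-! _≟_ xs) y∷xs⊆ys
    where
      y≢ : ∀ {z} → z ∈ deduplicate _≟_ xs → ¬ y ≡ z
      y≢ z∈ refl = y∉xs (∈-deduplicate⁻ _≟_ xs z∈)
      y∷xs⊆ys : y ∷ deduplicate _≟_ xs ⊆ deduplicate _≟_ ys
      y∷xs⊆ys (here refl) = ∈-deduplicate⁺ _≟_ y∈ys
      y∷xs⊆ys (there z∈)  = ∈-deduplicate⁺ _≟_ (sub (∈-deduplicate⁻ _≟_ xs z∈))

acc⇒no-descent : ∀ {A : Set} {_<_ : Rel A 0ℓ} (f : ℕ → A) → Acc _<_ (f 0) → ¬ (∀ n → f (suc n) < f n)
acc⇒no-descent f (acc rs) descent = acc⇒no-descent (f ∘ suc) (rs (descent 0)) (descent ∘ suc)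

_≺_ : ∀ {n} → Vec ℕ n → Vec ℕ n → Set
_≺_ = Lex-< _≡_ _<_

≺-wellFounded : ∀ {n} → WellFounded (_≺_ {n})
≺-wellFounded = <-wellFounded trans (proj₁ <-resp₂-≡) ℕ.<-wellFounded

∷-≺ : ∀ {n x y} {xs ys : Vec ℕ n} → x ≤ y → xs ≺ ys → (x ∷ xs) ≺ (y ∷ ys)
∷-≺ x≤y xs≺ys with m≤n⇒m<n∨m≡n x≤y
... | inj₁ x<y  = this x<y refl
... | inj₂ refl = next refl xs≺ys

histogram : (k : ℕ) → (ℕ → ℕ) → Vec ℕ k
histogram zero    c = []
histogram (suc k) c = c k ∷ histogram k c

histogram-≺ : ∀ {k c c' ℓ} → ℓ < k → (∀ {ℓ'} → ℓ < ℓ' → c' ℓ' ≤ c ℓ') → c' ℓ < c ℓ →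
              histogram k c' ≺ histogram k c
histogram-≺ {suc k} (s≤s ℓ≤k) above at with m≤n⇒m<n∨m≡n ℓ≤k
... | inj₁ ℓ<k  = ∷-≺ (above ℓ<k) (histogram-≺ ℓ<k above at)
... | inj₂ refl = this at refl

module _ {A B : Set} (h : A → B) where

  map-≡⇒∈zip-≡ : ∀ {xs ys a b} → map h xs ≡ map h ys → (a , b) ∈ zip xs ys → h a ≡ h b
  map-≡⇒∈zip-≡ {_ ∷ _} {_ ∷ _} eq (here refl) = proj₁ (∷-injective eq)
  map-≡⇒∈zip-≡ {_ ∷ _} {_ ∷ _} eq (there m)   = map-≡⇒∈zip-≡ (proj₂ (∷-injective eq)) m

  ∈zip-≡⇒map-≡ : ∀ {xs ys} → length xs ≡ length ys →
                 (∀ {a b} → (a , b) ∈ zip xs ys → h a ≡ h b) → map h xs ≡ map h ys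
  ∈zip-≡⇒map-≡ {[]}     {[]}     _   _ = refl
  ∈zip-≡⇒map-≡ {x ∷ xs} {y ∷ ys} len hz =
    cong₂ _∷_ (hz (here refl)) (∈zip-≡⇒map-≡ (suc-injective len) (hz ∘ there))

module _ {A B : Set} where

  ∈-zip⇒∈ˡ : ∀ {xs : List A} {ys : List B} {a b} → (a , b) ∈ zip xs ys → a ∈ xs
  ∈-zip⇒∈ˡ {_ ∷ _} {_ ∷ _} (here refl) = here refl
  ∈-zip⇒∈ˡ {_ ∷ _} {_ ∷ _} (there m)   = there (∈-zip⇒∈ˡ m)

  ∈-zip⇒∈ʳ : ∀ {xs : List A} {ys : List B} {a b} → (a , b) ∈ zip xs ys → b ∈ ys
  ∈-zip⇒∈ʳ {_ ∷ _} {_ ∷ _} (here refl) = here refl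
  ∈-zip⇒∈ʳ {_ ∷ _} {_ ∷ _} (there m)   = there (∈-zip⇒∈ʳ m)

-- Terms, truncation and solutions up to a depth

var-injective : ∀ {x y} → var x ≡ var y → x ≡ y
var-injective refl = refl

fun-injective : ∀ {f g ss ts} → fun f ss ≡ fun g ts → f ≡ g × ss ≡ ts
fun-injective refl = refl , refl

mutual
  _≟ₜ_ : DecidableEquality Term
  var x ≟ₜ var y = map′ (cong var) var-injective (x ≟ y)
  var _ ≟ₜ fun _ _ = no λ ()
  fun _ _ ≟ₜ var _ = no λ ()
  fun f ss ≟ₜ fun g ts =
    map′ (λ (f≡g , ss≡ts) → cong₂ fun f≡g ss≡ts) fun-injective (f ≟ g ×-dec ss ≟ₜ* ts)

  _≟ₜ*_ : DecidableEquality (List Term)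
  []       ≟ₜ* []       = yes refl
  []       ≟ₜ* (_ ∷ _)  = no λ ()
  (_ ∷ _)  ≟ₜ* []       = no λ ()
  (s ∷ ss) ≟ₜ* (t ∷ ts) = ∷-dec (s ≟ₜ t) (ss ≟ₜ* ts)

_≟ₑ_ : DecidableEquality Equation
_≟ₑ_ = ≡-dec _≟ₜ_ _≟ₜ_

_∘ₛ_ : Subst → Subst → Subst
(σ ∘ₛ τ) x = σ · τ x

mutual
  ·-∘ₛ : ∀ σ τ t → σ · (τ · t) ≡ (σ ∘ₛ τ) · t
  ·-∘ₛ σ τ (var x)    = refl
  ·-∘ₛ σ τ (fun f ts) = cong (fun f) (·*-∘ₛ σ τ ts)

  ·*-∘ₛ : ∀ σ τ ts → σ ·* (τ ·* ts) ≡ (σ ∘ₛ τ) ·* ts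
  ·*-∘ₛ σ τ []       = refl
  ·*-∘ₛ σ τ (t ∷ ts) = cong₂ _∷_ (·-∘ₛ σ τ t) (·*-∘ₛ σ τ ts)

-- Truncation at depth n; at depth 0 every term becomes var 0.
mutual
  cut : ℕ → Term → Term
  cut zero    _          = var 0
  cut (suc n) (var x)    = var x
  cut (suc n) (fun f ts) = fun f (cut* n ts)

  cut* : ℕ → List Term → List Term
  cut* n []       = []
  cut* n (t ∷ ts) = cut n t ∷ cut* n ts

mutual
  cut-cut-suc : ∀ n t → cut n (cut (suc n) t) ≡ cut n t
  cut-cut-suc zero    t          = refl
  cut-cut-suc (suc n) (var x)    = refl
  cut-cut-suc (suc n) (fun f ts) = cong (fun f) (cut*-cut*-suc n ts)

  cut*-cut*-suc : ∀ n ts → cut* n (cut* (suc n) ts) ≡ cut* n ts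
  cut*-cut*-suc n []       = refl
  cut*-cut*-suc n (t ∷ ts) = cong₂ _∷_ (cut-cut-suc n t) (cut*-cut*-suc n ts)

cut-pred : ∀ n {s t} → cut (suc n) s ≡ cut (suc n) t → cut n s ≡ cut n t
cut-pred n {s} {t} eq = begin
  cut n s                 ≡⟨ cut-cut-suc n s ⟨
  cut n (cut (suc n) s)   ≡⟨ cong (cut n) eq ⟩
  cut n (cut (suc n) t)   ≡⟨ cut-cut-suc n t ⟩
  cut n t                 ∎
  where open ≡-Reasoning

mutual
  cut-large : ∀ {n} t → size t ≤ n → cut n t ≡ t
  cut-large (var x)    (s≤s _)  = refl
  cut-large (fun f ts) (s≤s le) = cong (fun f) (cut*-large ts le)

  cut*-large : ∀ {n} ts → sizes ts ≤ n → cut* n ts ≡ ts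
  cut*-large []       _  = refl
  cut*-large (t ∷ ts) le =
    cong₂ _∷_ (cut-large t (≤-trans (m≤m+n _ _) le)) (cut*-large ts (≤-trans (m≤n+m _ _) le))

cut-all⇒≡ : ∀ {s t} → (∀ n → cut n s ≡ cut n t) → s ≡ t
cut-all⇒≡ {s} {t} h = begin
  s                           ≡⟨ cut-large s (m≤m+n _ _) ⟨
  cut (size s + size t) s     ≡⟨ h (size s + size t) ⟩
  cut (size s + size t) t     ≡⟨ cut-large t (m≤n+m _ _) ⟩
  t                           ∎
  where open ≡-Reasoning

mutual
  cut-·-cong : ∀ n {σ τ} → (∀ x → cut n (σ x) ≡ cut n (τ x)) → ∀ t → cut n (σ · t) ≡ cut n (τ · t)
  cut-·-cong n       h (var x)    = h x
  cut-·-cong zero    h (fun f ts) = refl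
  cut-·-cong (suc n) h (fun f ts) = cong (fun f) (cut*-·*-cong n (λ x → cut-pred n (h x)) ts)

  cut*-·*-cong : ∀ n {σ τ} → (∀ x → cut n (σ x) ≡ cut n (τ x)) →
                 ∀ ts → cut* n (σ ·* ts) ≡ cut* n (τ ·* ts)
  cut*-·*-cong n h []       = refl
  cut*-·*-cong n h (t ∷ ts) = cong₂ _∷_ (cut-·-cong n h t) (cut*-·*-cong n h ts)

cut-·-fun-cong : ∀ n {σ τ} → (∀ x → cut n (σ x) ≡ cut n (τ x)) →
                 ∀ f ts → cut (suc n) (σ · fun f ts) ≡ cut (suc n) (τ · fun f ts)
cut-·-fun-cong n h f ts = cong (fun f) (cut*-·*-cong n h ts)

cut*-·* : ∀ n θ ts → cut* n (θ ·* ts) ≡ map (cut n ∘ (θ ·_)) ts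
cut*-·* n θ []       = refl
cut*-·* n θ (t ∷ ts) = cong (cut n (θ · t) ∷_) (cut*-·* n θ ts)

_⊨ₑ[_]_ : Subst → ℕ → Equation → Set
θ ⊨ₑ[ n ] e = cut n (θ · proj₁ e) ≡ cut n (θ · proj₂ e)

_⊨[_]_ : Subst → ℕ → Eqs → Set
θ ⊨[ n ] E = ∀ {e} → e ∈ E → θ ⊨ₑ[ n ] e

_⊨ₛ[_]_ : Subst → ℕ → State → Set
θ ⊨ₛ[ n ] eqs E = θ ⊨[ n ] E
θ ⊨ₛ[ n ] fail  = ⊥

⊨-pred : ∀ {θ n E} → θ ⊨[ suc n ] E → θ ⊨[ n ] E
⊨-pred h m = cut-pred _ (h m)

decompose-⊨ : ∀ {θ n f g ss ts} → θ ⊨ₑ[ suc n ] (fun f ss , fun g ts) →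
              f ≡ g × length ss ≡ length ts × θ ⊨[ n ] zip ss ts
decompose-⊨ {θ} {n} {ss = ss} {ts} h with fun-injective h
... | f≡g , args≡ = f≡g , length≡ , map-≡⇒∈zip-≡ (cut n ∘ (θ ·_)) map≡
  where
    map≡ : map (cut n ∘ (θ ·_)) ss ≡ map (cut n ∘ (θ ·_)) ts
    map≡ = trans (sym (cut*-·* n θ ss)) (trans args≡ (cut*-·* n θ ts))
    length≡ : length ss ≡ length ts
    length≡ = trans (sym (length-map _ ss)) (trans (cong length map≡) (length-map _ ts))

compose-⊨ : ∀ {θ n f ss ts} → length ss ≡ length ts → θ ⊨[ n ] zip ss ts →
            θ ⊨ₑ[ n ] (fun f ss , fun f ts)
compose-⊨ {n = zero} _ _ = refl
compose-⊨ {θ} {suc n} {f} {ss} {ts} len h = cong (fun f) (begin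
  cut* n (θ ·* ss)          ≡⟨ cut*-·* n θ ss ⟩
  map (cut n ∘ (θ ·_)) ss   ≡⟨ ∈zip-≡⇒map-≡ (cut n ∘ (θ ·_)) len (⊨-pred h) ⟩
  map (cut n ∘ (θ ·_)) ts   ≡⟨ cut*-·* n θ ts ⟨
  cut* n (θ ·* ts)          ∎)
  where open ≡-Reasoning

Replaces-⊨ : ∀ {θ n E e N E'} → Replaces E e N E' → θ ⊨[ n ] E → θ ⊨[ n ] N → θ ⊨[ n ] E'
Replaces-⊨ R hE hN m with proj₁ (R _) m
... | inj₁ (m' , _) = hE m'
... | inj₂ m'       = hN m'

Replaces-⊨⁻ : ∀ {θ n E e N E'} → Replaces E e N E' → θ ⊨[ n ] E' →
              (θ ⊨[ n ] N → θ ⊨ₑ[ n ] e) → θ ⊨[ n ] E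
Replaces-⊨⁻ {e = e} R hE' he {x} m with x ≟ₑ e
... | yes refl = he (hE' ∘ proj₂ (R _) ∘ inj₂)
... | no x≢e   = hE' (proj₂ (R x) (inj₁ (m , x≢e)))

[↦]-⊨ : ∀ {θ n X t} → θ ⊨ₑ[ n ] (var X , t) → ∀ a → cut n (θ · ([ X ↦ t ] · a)) ≡ cut n (θ · a)
[↦]-⊨ {θ} {n} {X} {t} hX a = trans (cong (cut n) (·-∘ₛ θ [ X ↦ t ] a)) (cut-·-cong n pointwise a)
  where
    pointwise : ∀ x → cut n (θ · [ X ↦ t ] x) ≡ cut n (θ x)
    pointwise x with X ≟ x
    ... | yes refl = sym hX
    ... | no _     = refl

SubstOthers-⊨ : ∀ {θ n E E' X t} → (var X , t) ∈ E → SubstOthers E (var X , t) [ X ↦ t ] E' →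
                θ ⊨[ n ] E → θ ⊨[ n ] E'
SubstOthers-⊨ mX S h m with proj₁ (S _) m
... | inj₁ refl                     = h mX
... | inj₂ ((a , b) , m' , _ , refl) =
  trans ([↦]-⊨ (h mX) a) (trans (h m') (sym ([↦]-⊨ (h mX) b)))

SubstOthers-⊨⁻ : ∀ {θ n E E' X t} → SubstOthers E (var X , t) [ X ↦ t ] E' →
                 θ ⊨[ n ] E' → θ ⊨[ n ] E
SubstOthers-⊨⁻ {θ} {n} {X = X} {t} S h {a , b} m with (a , b) ≟ₑ (var X , t)
... | yes refl = h (proj₂ (S _) (inj₁ refl))
... | no ≢X    = begin
  cut n (θ · a)                    ≡⟨ [↦]-⊨ hX a ⟨
  cut n (θ · ([ X ↦ t ] · a))      ≡⟨ h (proj₂ (S _) (inj₂ (_ , m , ≢X , refl))) ⟩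
  cut n (θ · ([ X ↦ t ] · b))      ≡⟨ [↦]-⊨ hX b ⟩
  cut n (θ · b)                    ∎
  where
    open ≡-Reasoning
    hX : θ ⊨ₑ[ n ] (var X , t)
    hX = h (proj₂ (S _) (inj₁ refl))

commonStep-forward : ∀ {θ n E s} → CommonStep E s → θ ⊨[ suc n ] E → θ ⊨ₛ[ n ] s
commonStep-forward (decompose m _ R) h = Replaces-⊨ R (⊨-pred h) (proj₂ (proj₂ (decompose-⊨ (h m))))
commonStep-forward (clash m (inj₁ f≢g)) h = f≢g (proj₁ (decompose-⊨ (h m)))
commonStep-forward (clash m (inj₂ len≢)) h = len≢ (proj₁ (proj₂ (decompose-⊨ (h m))))
commonStep-forward (delete m R) h = Replaces-⊨ R (⊨-pred h) λ ()
commonStep-forward (swap m _ R) h = Replaces-⊨ R (⊨-pred h) λ { (here refl) → sym (cut-pred _ (h m)) }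

commonStep-backward : ∀ {θ n E s} → CommonStep E s → θ ⊨ₛ[ n ] s → θ ⊨[ n ] E
commonStep-backward (decompose _ len R) h = Replaces-⊨⁻ R h (compose-⊨ len)
commonStep-backward (delete _ R)        h = Replaces-⊨⁻ R h λ _ → refl
commonStep-backward (swap _ _ R)        h = Replaces-⊨⁻ R h λ hN → sym (hN (here refl))

minusStep-forward : ∀ {θ n E s} → MinusStep E s → θ ⊨[ suc n ] E → θ ⊨ₛ[ n ] s
minusStep-forward (common c)                 h = commonStep-forward c h
minusStep-forward (elimVar m _ _ S)          h = SubstOthers-⊨ m S (⊨-pred h)
minusStep-forward (merge mt mu _ _ _ _ R)    h =
  Replaces-⊨ R (⊨-pred h) λ { (here refl) → trans (sym (cut-pred _ (h mt))) (cut-pred _ (h mu)) }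

minusStep-backward : ∀ {θ n E s} → MinusStep E s → θ ⊨ₛ[ n ] s → θ ⊨[ n ] E
minusStep-backward (common c)              h = commonStep-backward c h
minusStep-backward (elimVar _ _ _ S)       h = SubstOthers-⊨⁻ S h
minusStep-backward (merge mt _ t≢u _ _ _ R) h =
  Replaces-⊨⁻ R h λ hN → trans (h (proj₂ (R _) (inj₁ (mt , t≢u ∘ cong proj₂)))) (hN (here refl))

mmaStep-forward : ∀ {θ n E s} → MMAStep E false s → θ ⊨[ suc n ] E → θ ⊨ₛ[ n ] s
mmaStep-forward (common c)            h = commonStep-forward c h
mmaStep-forward (eliminate m _ _ S)   h = SubstOthers-⊨ m S (⊨-pred h)

mmaStep-backward : ∀ {θ n E s} → MMAStep E false s → θ ⊨ₛ[ n ] s → θ ⊨[ n ] E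
mmaStep-backward (common c)           h = commonStep-backward c h
mmaStep-backward (eliminate _ _ _ S)  h = SubstOthers-⊨⁻ S h

Solves : Subst → State → Set
Solves θ s = ∀ n → θ ⊨ₛ[ n ] s

SolvableAtEachDepth : State → Set
SolvableAtEachDepth s = ∀ n → ∃ λ θ → θ ⊨ₛ[ n ] s

unifiable⇒solves : ∀ {E} → Unifiable E → ∃ λ θ → Solves θ (eqs E)
unifiable⇒solves (θ , u) = θ , λ n {e} m → cong (cut n) (u (proj₁ e) (proj₂ e) m)

solves⇒unifiable : ∀ {θ E} → Solves θ (eqs E) → Unifiable E
solves⇒unifiable {θ} h = θ , λ s t m → cut-all⇒≡ λ n → h n m

module Runs {_⟶_ : State → State → Set}
  (forward  : ∀ {θ n s s'} → s ⟶ s' → θ ⊨ₛ[ suc n ] s → θ ⊨ₛ[ n ] s')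
  (backward : ∀ {θ n s s'} → s ⟶ s' → θ ⊨ₛ[ n ] s' → θ ⊨ₛ[ n ] s) where

  run-solves : ∀ {θ s s'} → Star _⟶_ s s' → Solves θ s → Solves θ s'
  run-solves ε          h = h
  run-solves (st ◅ run) h = run-solves run λ n → forward st (h (suc n))

  run-solvableAtEachDepth : ∀ {s s'} → Star _⟶_ s s' → SolvableAtEachDepth s → SolvableAtEachDepth s'
  run-solvableAtEachDepth ε          h = h
  run-solvableAtEachDepth (st ◅ run) h =
    run-solvableAtEachDepth run λ n → let θ , hθ = h (suc n) in θ , forward st hθ

  run-⊨⁻ : ∀ {θ n s s'} → Star _⟶_ s s' → θ ⊨ₛ[ n ] s' → θ ⊨ₛ[ n ] s
  run-⊨⁻ ε          h = h
  run-⊨⁻ (st ◅ run) h = backward st (run-⊨⁻ run h)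

minus-forward : ∀ {θ n s s'} → s ⟶⁻ s' → θ ⊨ₛ[ suc n ] s → θ ⊨ₛ[ n ] s'
minus-forward (step st) = minusStep-forward st

minus-backward : ∀ {θ n s s'} → s ⟶⁻ s' → θ ⊨ₛ[ n ] s' → θ ⊨ₛ[ n ] s
minus-backward (step st) = minusStep-backward st

no6-forward : ∀ {θ n s s'} → s ⟶no6 s' → θ ⊨ₛ[ suc n ] s → θ ⊨ₛ[ n ] s'
no6-forward (step st) = mmaStep-forward st

no6-backward : ∀ {θ n s s'} → s ⟶no6 s' → θ ⊨ₛ[ n ] s' → θ ⊨ₛ[ n ] s
no6-backward (step st) = mmaStep-backward st

module MinusRuns = Runs minus-forward minus-backward
module No6Runs   = Runs no6-forward no6-backward

-- Halted states

mutual
  ·-fixes : ∀ {σ} t → (∀ {z} → z occ t → σ z ≡ var z) → σ · t ≡ t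
  ·-fixes (var x)    h = h here
  ·-fixes (fun f ts) h = cong (fun f) (·*-fixes ts λ t∈ts → h ∘ arg t∈ts)

  ·*-fixes : ∀ {σ} ts → (∀ {z t} → t ∈ ts → z occ t → σ z ≡ var z) → σ ·* ts ≡ ts
  ·*-fixes []       h = refl
  ·*-fixes (t ∷ ts) h = cong₂ _∷_ (·-fixes t (h (here refl))) (·*-fixes ts (h ∘ there))

Bound : Eqs → ℕ → Set
Bound E x = ∃ λ t → (var x , t) ∈ E

bound? : ∀ E x → Dec (Bound E x)
bound? E x = map′ witness (λ (_ , m) → lose m refl) (any? (λ e → proj₁ e ≟ₜ var x) E)
  where
    witness : Any (λ e → proj₁ e ≡ var x) E → Bound E x
    witness a with find a
    ... | (_ , t) , m , refl = t , m

rhs : Eqs → ℕ → Term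
rhs E x with bound? E x
... | yes (t , _) = t
... | no _        = var x

rhs-∈ : ∀ {E x} → Bound E x → (var x , rhs E x) ∈ E
rhs-∈ {E} {x} b with bound? E x
... | yes (_ , m) = m
... | no ¬b       = ⊥-elim (¬b b)

remove : Equation → Eqs → Eqs
remove e = filter (λ x → ¬? (x ≟ₑ e))

replaces-remove : ∀ E e N → Replaces E e N (remove e E ++ N)
replaces-remove E e N x = to , from
  where
    to : x ∈ remove e E ++ N → (x ∈ E × x ≢ e) ⊎ x ∈ N
    to m with ∈-++⁻ (remove e E) m
    ... | inj₁ m' = inj₁ (∈-filter⁻ (λ x → ¬? (x ≟ₑ e)) m')
    ... | inj₂ m' = inj₂ m'
    from : (x ∈ E × x ≢ e) ⊎ x ∈ N → x ∈ remove e E ++ N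
    from (inj₁ (m , x≢e)) = ∈-++⁺ˡ (∈-filter⁺ (λ x → ¬? (x ≟ₑ e)) m x≢e)
    from (inj₂ m)         = ∈-++⁺ʳ (remove e E) m

substOthers-remove : ∀ E e σ → SubstOthers E e σ (e ∷ map (σ ·ₑ_) (remove e E))
substOthers-remove E e σ x = to , from
  where
    to : x ∈ e ∷ map (σ ·ₑ_) (remove e E) → x ≡ e ⊎ ∃ λ y → y ∈ E × y ≢ e × x ≡ σ ·ₑ y
    to (here refl) = inj₁ refl
    to (there m) with ∈-map⁻ (σ ·ₑ_) m
    ... | y , m' , refl =
      let y∈E , y≢e = ∈-filter⁻ (λ x → ¬? (x ≟ₑ e)) m' in inj₂ (y , y∈E , y≢e , refl)
    from : x ≡ e ⊎ (∃ λ y → y ∈ E × y ≢ e × x ≡ σ ·ₑ y) → x ∈ e ∷ map (σ ·ₑ_) (remove e E)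
    from (inj₁ refl)                = here refl
    from (inj₂ (y , y∈E , y≢e , refl)) = there (∈-map⁺ (σ ·ₑ_) (∈-filter⁺ (λ x → ¬? (x ≟ₑ e)) y∈E y≢e))

fun-nonVar : ∀ {f ts} → NonVar (fun f ts)
fun-nonVar (_ , ())

commonStep-or-binding : ∀ {E e} → e ∈ E →
  (∃ λ s → CommonStep E s) ⊎ (∃₂ λ X t → e ≡ (var X , t) × var X ≢ t)
commonStep-or-binding {E} {fun f ss , fun g ts} m with f ≟ g | length ss ≟ length ts
... | yes refl | yes len = inj₁ (_ , decompose m len (replaces-remove E _ _))
... | yes refl | no len≢ = inj₁ (_ , clash m (inj₂ len≢))
... | no f≢g   | _       = inj₁ (_ , clash m (inj₁ f≢g))
commonStep-or-binding {E} {fun f ss , var X} m = inj₁ (_ , swap m fun-nonVar (replaces-remove E _ _))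
commonStep-or-binding {E} {var X , var Y} m with X ≟ Y
... | yes refl = inj₁ (_ , delete m (replaces-remove E _ _))
... | no X≢Y   = inj₂ (X , var Y , refl , X≢Y ∘ var-injective)
commonStep-or-binding {E} {var X , fun g ts} m = inj₂ (X , fun g ts , refl , λ ())

mmaHalted⇒unifiable : ∀ {E} → MMAHalted (eqs E) → Unifiable E
mmaHalted⇒unifiable {E} halted = rhs E , solves
  where
    occurs-not : ∀ {X t} → (var X , t) ∈ E → ¬ X occ t
    occurs-not {X} {t} m o with var X ≟ₜ t
    ... | yes refl = halted false _ (common (delete m (replaces-remove E _ _)))
    ... | no X≢t   = halted true fail (occurFail m o X≢t)

    occurs-only-here : ∀ {X t} → (var X , t) ∈ E → ¬ OccursElsewhere X (var X , t) E
    occurs-only-here m oe = halted false _ (eliminate m (occurs-not m) oe (substOthers-remove E _ _))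

    rhs-of-binding : ∀ {X t} → (var X , t) ∈ E → rhs E X ≡ t
    rhs-of-binding {X} {t} m with rhs E X ≟ₜ t
    ... | yes eq = eq
    ... | no ≢t  = ⊥-elim (occurs-only-here m (_ , rhs-∈ (t , m) , ≢t ∘ cong proj₂ , inj₁ here))

    rhs-fixes : ∀ {X t} → (var X , t) ∈ E → rhs E · t ≡ t
    rhs-fixes {X} {t} m = ·-fixes t unbound
      where
        unbound : ∀ {z} → z occ t → rhs E z ≡ var z
        unbound {z} o with bound? E z
        ... | no _         = refl
        ... | yes (u , mz) =
          ⊥-elim (occurs-only-here mz (_ , m , X≢z ∘ var-injective ∘ cong proj₁ , inj₂ o))
          where
            X≢z : X ≢ z
            X≢z refl = occurs-not m o

    solves : ∀ s t → (s , t) ∈ E → rhs E · s ≡ rhs E · t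
    solves s t m with commonStep-or-binding m
    ... | inj₁ (s' , st)         = ⊥-elim (halted false s' (common st))
    ... | inj₂ (X , _ , refl , _) = trans (rhs-of-binding m) (sym (rhs-fixes m))

minusHalted⇒semiSolved : ∀ {E} → MinusHalted (eqs E) → SemiSolved E
minusHalted⇒semiSolved {E} halted = binding , functional , isolated
  where
    elim-or-delete : ∀ {X Y} → (var X , var Y) ∈ E → ¬ OccursElsewhere X (var X , var Y) E
    elim-or-delete {X} {Y} m oe with X ≟ Y
    ... | yes refl = halted _ (common (delete m (replaces-remove E _ _)))
    ... | no X≢Y   = halted _ (elimVar m X≢Y oe (substOthers-remove E _ _))

    binding : ∀ e → e ∈ E → ∃₂ λ X t → e ≡ (var X , t) × var X ≢ t
    binding e m with commonStep-or-binding m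
    ... | inj₁ (s , st) = ⊥-elim (halted s (common st))
    ... | inj₂ b        = b

    functional : ∀ X t u → (var X , t) ∈ E → (var X , u) ∈ E → t ≡ u
    functional X t u mt mu with t ≟ₜ u
    ... | yes t≡u = t≡u
    ... | no t≢u  = ⊥-elim (distinct t u mt mu t≢u)
      where
        distinct : ∀ t u → (var X , t) ∈ E → (var X , u) ∈ E → t ≢ u → ⊥
        distinct (var Y) u mt mu t≢u = elim-or-delete mt (_ , mu , t≢u ∘ sym ∘ cong proj₂ , inj₁ here)
        distinct (fun _ _) (var Y) mt mu t≢u = elim-or-delete mu (_ , mt , t≢u ∘ cong proj₂ , inj₁ here)
        distinct (fun f ts) (fun g us) mt mu t≢u with size (fun f ts) ≤? size (fun g us)
        ... | yes t≤u = halted _ (merge mt mu t≢u fun-nonVar fun-nonVar t≤u (replaces-remove E _ _))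
        ... | no t≰u  =
          halted _ (merge mu mt (t≢u ∘ sym) fun-nonVar fun-nonVar (≰⇒≥ t≰u) (replaces-remove E _ _))

    isolated : ∀ X Y → (var X , var Y) ∈ E → ∀ e → e ∈ E → e ≢ (var X , var Y) → ¬ OccEq X e
    isolated X Y m e me e≢ o = elim-or-delete m (e , me , e≢ , o)

-- approx k is the depth-k approximation of the rational-tree solution of E when E is
-- semi-solved: rep follows a binding X ≐ Y (such chains have length one there) and unfold
-- expands functional right-hand sides k times.
module Unfolding (E : Eqs) where

  representative : ℕ → Term → ℕ
  representative z (var y)   = y
  representative z (fun _ _) = z

  rep : ℕ → ℕ
  rep z = representative z (rhs E z)

  mutual
    unfold : ℕ → ℕ → Term
    unfold zero    w = var w
    unfold (suc k) w = unfoldRhs k w (rhs E w)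

    unfoldRhs : ℕ → ℕ → Term → Term
    unfoldRhs k w (var _)    = var w
    unfoldRhs k w (fun f ts) = approx k · fun f ts

    approx : ℕ → Subst
    approx k z = unfold k (rep z)

  unfold-step : ∀ k w → cut k (unfold k w) ≡ cut k (unfold (suc k) w)
  unfold-step zero    w = refl
  unfold-step (suc k) w = rhs-step (rhs E w)
    where
      rhs-step : ∀ t → cut (suc k) (unfoldRhs k w t) ≡ cut (suc k) (unfoldRhs (suc k) w t)
      rhs-step (var _)    = refl
      rhs-step (fun f ts) = cut-·-fun-cong k (λ z → unfold-step k (rep z)) f ts

  rep-fixed : ∀ {Y} → (∀ {W} → (var Y , var W) ∉ E) → rep Y ≡ Y
  rep-fixed {Y} noVarRhs with bound? E Y
  ... | no _                = refl
  ... | yes (var W , m)     = ⊥-elim (noVarRhs m)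
  ... | yes (fun _ _ , _)   = refl

  approx-solves : SemiSolved E → ∀ n → approx n ⊨[ n ] E
  approx-solves (binding , functional , isolated) n m with binding _ m
  ... | X , t , refl , X≢t = solves-binding n t m X≢t
    where
      rhs-X : ∀ {t} → (var X , t) ∈ E → rhs E X ≡ t
      rhs-X m = functional X _ _ (rhs-∈ (_ , m)) m

      solves-binding : ∀ n t → (var X , t) ∈ E → var X ≢ t → approx n ⊨ₑ[ n ] (var X , t)
      solves-binding n (var Y) m X≢Y = cong (cut n) (begin
        unfold n (rep X)                   ≡⟨ cong (unfold n ∘ representative X) (rhs-X m) ⟩
        unfold n Y                         ≡⟨ cong (unfold n) (rep-fixed Y-noVarRhs) ⟨
        unfold n (rep Y)                   ∎)
        where
          open ≡-Reasoning
          Y-noVarRhs : ∀ {W} → (var Y , var W) ∉ E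
          Y-noVarRhs {W} mYW = isolated Y W mYW (var X , var Y) m (X≢Y ∘ cong proj₁) (inj₂ here)
      solves-binding zero    (fun f ts) m _ = refl
      solves-binding (suc k) (fun f ts) m _ = begin
        cut (suc k) (unfold (suc k) (rep X))
          ≡⟨ cong (λ u → cut (suc k) (unfold (suc k) (representative X u))) (rhs-X m) ⟩
        cut (suc k) (unfoldRhs k X (rhs E X))
          ≡⟨ cong (cut (suc k) ∘ unfoldRhs k X) (rhs-X m) ⟩
        cut (suc k) (approx k · fun f ts)
          ≡⟨ cut-·-fun-cong k (λ z → unfold-step k (rep z)) f ts ⟩
        cut (suc k) (approx (suc k) · fun f ts)
          ∎
        where open ≡-Reasoning

semiSolved-solvableAtEachDepth : ∀ {E} → SemiSolved E → SolvableAtEachDepth (eqs E)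
semiSolved-solvableAtEachDepth {E} S n = approx n , approx-solves S n
  where open Unfolding E

wnsto-solvableAtEachDepth⇒unifiable : ∀ {E} → WNSTO E → SolvableAtEachDepth (eqs E) → Unifiable E
wnsto-solvableAtEachDepth⇒unifiable (fail , run , _) h =
  ⊥-elim (proj₂ (No6Runs.run-solvableAtEachDepth run h 0))
wnsto-solvableAtEachDepth⇒unifiable (eqs E' , run , halted) _ =
  let θ , θ-solves = unifiable⇒solves (mmaHalted⇒unifiable halted)
  in solves⇒unifiable λ n → No6Runs.run-⊨⁻ run (θ-solves n)

minus-correct : ∀ {E} → WNSTO E → ∀ s → Star _⟶⁻_ (eqs E) s → MinusHalted s → CorrectOutcome E s
minus-correct _ fail run _ = (λ _ → refl) , λ u →
  let θ , θ-solves = unifiable⇒solves u in ⊥-elim (MinusRuns.run-solves run θ-solves 0)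
minus-correct w (eqs E') run halted = not-unifiable , unifiable
  where
    semiSolved : SemiSolved E'
    semiSolved = minusHalted⇒semiSolved halted

    not-unifiable : ¬ Unifiable _ → eqs E' ≡ fail
    not-unifiable ¬u = ⊥-elim (¬u (wnsto-solvableAtEachDepth⇒unifiable w λ n →
      let θ , θ-solves = semiSolved-solvableAtEachDepth semiSolved n
      in θ , MinusRuns.run-⊨⁻ run θ-solves))

    unifiable : Unifiable _ → ∃ λ E'' → eqs E' ≡ eqs E'' × Unifiable E'' × SemiSolved E''
    unifiable u = let θ , θ-solves = unifiable⇒solves u in
      E' , refl , solves⇒unifiable (MinusRuns.run-solves run θ-solves) , semiSolved

-- Variables, weights and isolated variables

mutual
  varsₜ : Term → List ℕ
  varsₜ (var x)    = [ x ]
  varsₜ (fun f ts) = varsₜ* ts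

  varsₜ* : List Term → List ℕ
  varsₜ* []       = []
  varsₜ* (t ∷ ts) = varsₜ t ++ varsₜ* ts

mutual
  occ⇒∈varsₜ : ∀ {x t} → x occ t → x ∈ varsₜ t
  occ⇒∈varsₜ here         = here refl
  occ⇒∈varsₜ (arg t∈ts o) = occ⇒∈varsₜ* t∈ts o

  occ⇒∈varsₜ* : ∀ {x t ts} → t ∈ ts → x occ t → x ∈ varsₜ* ts
  occ⇒∈varsₜ* (here refl) o = ∈-++⁺ˡ (occ⇒∈varsₜ o)
  occ⇒∈varsₜ* {ts = u ∷ _} (there t∈ts) o = ∈-++⁺ʳ (varsₜ u) (occ⇒∈varsₜ* t∈ts o)

mutual
  ∈varsₜ⇒occ : ∀ {x} t → x ∈ varsₜ t → x occ t
  ∈varsₜ⇒occ (var x)    (here refl) = here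
  ∈varsₜ⇒occ (fun f ts) x∈          = let _ , t∈ts , o = ∈varsₜ*⇒occ ts x∈ in arg t∈ts o

  ∈varsₜ*⇒occ : ∀ {x} ts → x ∈ varsₜ* ts → ∃ λ t → t ∈ ts × x occ t
  ∈varsₜ*⇒occ (t ∷ ts) x∈ with ∈-++⁻ (varsₜ t) x∈
  ... | inj₁ x∈t  = t , here refl , ∈varsₜ⇒occ t x∈t
  ... | inj₂ x∈ts = let u , u∈ts , o = ∈varsₜ*⇒occ ts x∈ts in u , there u∈ts , o

occ? : ∀ x t → Dec (x occ t)
occ? x t = map′ (∈varsₜ⇒occ t) occ⇒∈varsₜ (x ∈? varsₜ t)

occEq? : ∀ x e → Dec (OccEq x e)
occEq? x (s , t) = occ? x s ⊎-dec occ? x t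

OccursIn : ℕ → Eqs → Set
OccursIn x S = ∃ λ e → e ∈ S × OccEq x e

varsₑ : Equation → List ℕ
varsₑ (s , t) = varsₜ s ++ varsₜ t

vars : Eqs → List ℕ
vars = concatMap varsₑ

occursIn⇒∈vars : ∀ {x S} → OccursIn x S → x ∈ vars S
occursIn⇒∈vars ((s , t) , e∈S , o) = ∈-concatMap⁺ varsₑ (lose e∈S (occEq⇒∈ o))
  where
    occEq⇒∈ : OccEq _ (s , t) → _ ∈ varsₑ (s , t)
    occEq⇒∈ (inj₁ o) = ∈-++⁺ˡ (occ⇒∈varsₜ o)
    occEq⇒∈ (inj₂ o) = ∈-++⁺ʳ (varsₜ s) (occ⇒∈varsₜ o)

∈vars⇒occursIn : ∀ {x S} → x ∈ vars S → OccursIn x S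
∈vars⇒occursIn {S = S} x∈ with find (∈-concatMap⁻ varsₑ {xs = S} x∈)
... | (s , t) , e∈S , x∈st with ∈-++⁻ (varsₜ s) x∈st
...   | inj₁ x∈s = _ , e∈S , inj₁ (∈varsₜ⇒occ s x∈s)
...   | inj₂ x∈t = _ , e∈S , inj₂ (∈varsₜ⇒occ t x∈t)

-- At equal size f(..) ≐ g(..) is lighter than X ≐ f(..), which is lighter than f(..) ≐ X,
-- so that (4) and (5b) lower the weight; (1) lowers the size.
shape : Term → Term → ℕ
shape (var _)   (fun _ _) = 1
shape (fun _ _) (var _)   = 2
shape _         _         = 0

weight : Equation → ℕ
weight (s , t) = shape s t + 3 * (size s ⊔ size t)

shape<3 : ∀ s t → shape s t < 3
shape<3 (var _)   (var _)   = s≤s z≤n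
shape<3 (var _)   (fun _ _) = s≤s (s≤s z≤n)
shape<3 (fun _ _) (var _)   = s≤s (s≤s (s≤s z≤n))
shape<3 (fun _ _) (fun _ _) = s≤s z≤n

∈⇒size≤sizes : ∀ {t ts} → t ∈ ts → size t ≤ sizes ts
∈⇒size≤sizes {ts = t ∷ ts} (here refl) = m≤m+n (size t) (sizes ts)
∈⇒size≤sizes {ts = u ∷ ts} (there t∈ts) = ≤-trans (∈⇒size≤sizes t∈ts) (m≤n+m (sizes ts) (size u))

weight-decompose : ∀ {f g ss ts e} → e ∈ zip ss ts → weight e < weight (fun f ss , fun g ts)
weight-decompose {f} {g} {ss} {ts} {a , b} m = begin-strict
  shape a b + 3 * (size a ⊔ size b)     <⟨ +-monoˡ-< _ (shape<3 a b) ⟩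
  3 + 3 * (size a ⊔ size b)             ≡⟨ *-suc 3 (size a ⊔ size b) ⟨
  3 * suc (size a ⊔ size b)             ≤⟨ *-monoʳ-≤ 3 (s≤s (⊔-mono-≤ a≤ b≤)) ⟩
  3 * (size (fun f ss) ⊔ size (fun g ts)) ≤⟨ m≤n+m _ (shape (fun f ss) (fun g ts)) ⟩
  weight (fun f ss , fun g ts)          ∎
  where
    open ≤-Reasoning
    a≤ : size a ≤ sizes ss
    a≤ = ∈⇒size≤sizes (∈-zip⇒∈ˡ m)
    b≤ : size b ≤ sizes ts
    b≤ = ∈⇒size≤sizes (∈-zip⇒∈ʳ m)

weight-swap : ∀ {X t} → NonVar t → weight (var X , t) < weight (t , var X)
weight-swap {t = var y}    nonVar = ⊥-elim (nonVar (y , refl))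
weight-swap {t = fun f ts} _ rewrite ⊔-identityʳ (sizes ts) = ≤-refl

weight-merge : ∀ {X t u} → NonVar t → NonVar u → size t ≤ size u → weight (t , u) < weight (var X , u)
weight-merge {t = var y}               nonVar _ _ = ⊥-elim (nonVar (y , refl))
weight-merge {t = fun _ _} {u = var y} _ nonVar _ = ⊥-elim (nonVar (y , refl))
weight-merge {t = fun _ _} {u = fun _ _} _ _ (s≤s t≤u) rewrite m≤n⇒m⊔n≡n t≤u = ≤-refl

Renaming : Subst → Set
Renaming σ = ∀ x → IsVar (σ x)

mutual
  renaming-size : ∀ {σ} → Renaming σ → ∀ t → size (σ · t) ≡ size t
  renaming-size ρ (var x)    rewrite proj₂ (ρ x) = refl
  renaming-size ρ (fun f ts) = cong suc (renaming-sizes ρ ts)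

  renaming-sizes : ∀ {σ} → Renaming σ → ∀ ts → sizes (σ ·* ts) ≡ sizes ts
  renaming-sizes ρ []       = refl
  renaming-sizes ρ (t ∷ ts) = cong₂ _+_ (renaming-size ρ t) (renaming-sizes ρ ts)

renaming-shape : ∀ {σ} → Renaming σ → ∀ s t → shape (σ · s) (σ · t) ≡ shape s t
renaming-shape ρ (var x)   (var y)   rewrite proj₂ (ρ x) | proj₂ (ρ y) = refl
renaming-shape ρ (var x)   (fun _ _) rewrite proj₂ (ρ x) = refl
renaming-shape ρ (fun _ _) (var y)   rewrite proj₂ (ρ y) = refl
renaming-shape ρ (fun _ _) (fun _ _) = refl

renaming-weight : ∀ {σ} → Renaming σ → ∀ e → weight (σ ·ₑ e) ≡ weight e
renaming-weight ρ (s , t) =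
  cong₂ _+_ (renaming-shape ρ s t) (cong (3 *_) (cong₂ _⊔_ (renaming-size ρ s) (renaming-size ρ t)))

[↦]-≢ : ∀ {X w} t → X ≢ w → [ X ↦ t ] w ≡ var w
[↦]-≢ {X} {w} t X≢w with X ≟ w
... | yes X≡w = ⊥-elim (X≢w X≡w)
... | no _    = refl

[↦var]-var : ∀ X Y w → ∃ λ w' → [ X ↦ var Y ] w ≡ var w' × (w' ≡ Y ⊎ (w' ≡ w × X ≢ w))
[↦var]-var X Y w with X ≟ w
... | yes _  = Y , refl , inj₁ refl
... | no X≢w = w , refl , inj₂ (refl , X≢w)

[↦var]-renaming : ∀ {X Y} → Renaming [ X ↦ var Y ]
[↦var]-renaming {X} {Y} w = let w' , eq , _ = [↦var]-var X Y w in w' , eq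

∈-·* : ∀ {σ u} ts → u ∈ σ ·* ts → ∃ λ t → t ∈ ts × u ≡ σ · t
∈-·* (t ∷ ts) (here refl) = t , here refl , refl
∈-·* (t ∷ ts) (there m)   = let t' , t'∈ts , eq = ∈-·* ts m in t' , there t'∈ts , eq

occ-· : ∀ {σ z} t → z occ (σ · t) → ∃ λ w → w occ t × z occ σ w
occ-· (var w)    o = w , here , o
occ-· (fun f ts) (arg m o) with ∈-·* ts m
... | t , t∈ts , refl = let w , w∈t , o' = occ-· t o in w , arg t∈ts w∈t , o'

occ-var : ∀ {z w} → z occ var w → z ≡ w
occ-var here = refl

occ-[↦var] : ∀ {X Y z} t → z occ ([ X ↦ var Y ] · t) → z ≡ Y ⊎ (z occ t × z ≢ X)
occ-[↦var] {X} t o with occ-· t o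
... | w , w∈t , z∈σw with X ≟ w
...   | yes _  = inj₁ (occ-var z∈σw)
...   | no X≢w with occ-var z∈σw
...     | refl = inj₂ (w∈t , X≢w ∘ sym)

occEq-[↦var] : ∀ {X Y z} e → OccEq z ([ X ↦ var Y ] ·ₑ e) → z ≡ Y ⊎ (OccEq z e × z ≢ X)
occEq-[↦var] (s , t) (inj₁ o) with occ-[↦var] s o
... | inj₁ z≡Y         = inj₁ z≡Y
... | inj₂ (o' , z≢X)  = inj₂ (inj₁ o' , z≢X)
occEq-[↦var] (s , t) (inj₂ o) with occ-[↦var] t o
... | inj₁ z≡Y         = inj₁ z≡Y
... | inj₂ (o' , z≢X)  = inj₂ (inj₂ o' , z≢X)

VarBinding : ℕ → Equation → Set
VarBinding X e = ∃ λ Y → X ≢ Y × e ≡ (var X , var Y)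

Isolates : Eqs → ℕ → Equation → Set
Isolates S X e = VarBinding X e × (∀ {e'} → e' ∈ S → OccEq X e' → e' ≡ e)

Isolated : Eqs → ℕ → Set
Isolated S X = ∃ λ e → e ∈ S × Isolates S X e

varBinding? : ∀ X e → Dec (VarBinding X e)
varBinding? X (var X' , var Y) with X' ≟ X | X ≟ Y
... | no X'≢X  | _        = no λ (_ , _ , eq) → X'≢X (var-injective (cong proj₁ eq))
... | yes refl | yes refl = no λ { (_ , X≢X , refl) → X≢X refl }
... | yes refl | no X≢Y   = yes (Y , X≢Y , refl)
varBinding? X (var _ , fun _ _) = no λ { (_ , _ , ()) }
varBinding? X (fun _ _ , _)     = no λ { (_ , _ , ()) }

isolated? : ∀ S X → Dec (Isolated S X)
isolated? S X = map′ find (λ (_ , m , i) → lose m i) (any? isolates? S)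
  where
    isolates? : ∀ e → Dec (Isolates S X e)
    isolates? e = varBinding? X e ×-dec
      map′ All.lookup All.tabulate (all? (λ e' → occEq? X e' →-dec e' ≟ₑ e) S)

nonIsolated : Eqs → List ℕ
nonIsolated S = filter (¬? ∘ isolated? S) (vars S)

-- Termination of MMA⁻

WeightBound : ℕ → Eqs → Set
WeightBound K S = ∀ {e} → e ∈ S → weight e < K

initialWeightBound : ∀ E → WeightBound (suc (max 0 (map weight E))) E
initialWeightBound E e∈E =
  s≤s (v≤max⁺ 0 (map weight E) (inj₂ (Any.map ≤-reflexive (∈-map⁺ weight e∈E))))

hasWeight? : ∀ ℓ e → Dec (weight e ≡ ℓ)
hasWeight? ℓ e = weight e ≟ ℓ

ofWeight : ℕ → Eqs → Eqs
ofWeight ℓ = filter (hasWeight? ℓ)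

measure : (K : ℕ) → Eqs → Vec ℕ (suc K)
measure K S =
  countDistinct _≟_ (nonIsolated S) ∷ histogram K λ ℓ → countDistinct _≟ₑ_ (ofWeight ℓ S)

nonIsolated-⊆ : ∀ {S S'} → (∀ {x} → OccursIn x S' → OccursIn x S) →
                (∀ {Z} → Isolated S Z → Isolated S' Z) → nonIsolated S' ⊆ nonIsolated S
nonIsolated-⊆ {S} {S'} occurs isolated x∈ =
  let x∈vars , ¬iso = ∈-filter⁻ (¬? ∘ isolated? S') {xs = vars S'} x∈
  in ∈-filter⁺ (¬? ∘ isolated? S) (occursIn⇒∈vars (occurs (∈vars⇒occursIn x∈vars)))
                (¬iso ∘ isolated)

record Lowering (S : Eqs) (e : Equation) (N : Eqs) : Set where
  field
    e∈S         : e ∈ S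
    ¬varBinding : ∀ {X} → ¬ VarBinding X e
    N-occurs    : ∀ {x e'} → e' ∈ N → OccEq x e' → ∃ λ e'' → e'' ∈ S × ¬ VarBinding x e'' × OccEq x e''
    N-lighter   : ∀ {e'} → e' ∈ N → weight e' < weight e

module LoweringStep {S e N S'} (L : Lowering S e N) (R : Replaces S e N S') where
  open Lowering L

  occurs : ∀ {x} → OccursIn x S' → OccursIn x S
  occurs (e' , e'∈ , o) with proj₁ (R e') e'∈
  ... | inj₁ (e'∈S , _) = e' , e'∈S , o
  ... | inj₂ e'∈N       = let e'' , e''∈S , _ , o'' = N-occurs e'∈N o in e'' , e''∈S , o''

  isolated : ∀ {Z} → Isolated S Z → Isolated S' Z
  isolated {Z} (eZ , eZ∈S , binding , only) = eZ , proj₂ (R eZ) (inj₁ (eZ∈S , eZ≢e)) , binding , only'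
    where
      eZ≢e : eZ ≢ e
      eZ≢e refl = ¬varBinding binding
      only' : ∀ {e'} → e' ∈ S' → OccEq Z e' → e' ≡ eZ
      only' {e'} e'∈ o with proj₁ (R e') e'∈
      ... | inj₁ (e'∈S , _) = only e'∈S o
      ... | inj₂ e'∈N       = let _ , e''∈S , ¬binding , o'' = N-occurs e'∈N o
                              in ⊥-elim (¬binding (subst (VarBinding Z) (sym (only e''∈S o'')) binding))

  weightBound : ∀ {K} → WeightBound K S → WeightBound K S'
  weightBound bound {e'} e'∈ with proj₁ (R e') e'∈
  ... | inj₁ (e'∈S , _) = bound e'∈S
  ... | inj₂ e'∈N       = <-trans (N-lighter e'∈N) (bound e∈S)

  heavy-⊆ : ∀ {ℓ} → weight e ≤ ℓ → ofWeight ℓ S' ⊆ ofWeight ℓ S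
  heavy-⊆ {ℓ} w≤ℓ e'∈ with ∈-filter⁻ (hasWeight? ℓ) {xs = S'} e'∈
  ... | e'∈S' , refl with proj₁ (R _) e'∈S'
  ...   | inj₁ (e'∈S , _) = ∈-filter⁺ (hasWeight? ℓ) e'∈S refl
  ...   | inj₂ e'∈N       = ⊥-elim (≤⇒≯ w≤ℓ (N-lighter e'∈N))

  e∉S' : e ∉ S'
  e∉S' e∈ with proj₁ (R e) e∈
  ... | inj₁ (_ , e≢e) = e≢e refl
  ... | inj₂ e∈N       = <-irrefl refl (N-lighter e∈N)

  decreases : ∀ {K} → WeightBound K S → measure K S' ≺ measure K S
  decreases bound = ∷-≺ (countDistinct-mono _≟_ (nonIsolated-⊆ occurs isolated))
    (histogram-≺ (bound e∈S) (countDistinct-mono _≟ₑ_ ∘ heavy-⊆ ∘ <⇒≤)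
      (countDistinct-< _≟ₑ_ (heavy-⊆ ≤-refl) (∈-filter⁺ (hasWeight? _) e∈S refl)
        (e∉S' ∘ proj₁ ∘ ∈-filter⁻ (hasWeight? _) {xs = S'})))

nonVarˡ⇒¬varBinding : ∀ {X s t} → NonVar s → ¬ VarBinding X (s , t)
nonVarˡ⇒¬varBinding nonVar (_ , _ , refl) = nonVar (_ , refl)

nonVarʳ⇒¬varBinding : ∀ {X s t} → NonVar t → ¬ VarBinding X (s , t)
nonVarʳ⇒¬varBinding nonVar (_ , _ , refl) = nonVar (_ , refl)

decompose-lowering : ∀ {S f ss ts} → (fun f ss , fun f ts) ∈ S →
                     Lowering S (fun f ss , fun f ts) (zip ss ts)
decompose-lowering {f = f} m = record
  { e∈S         = m
  ; ¬varBinding = nonVarˡ⇒¬varBinding λ ()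
  ; N-occurs    = λ where
      e'∈N (inj₁ o) → _ , m , nonVarˡ⇒¬varBinding (λ ()) , inj₁ (arg (∈-zip⇒∈ˡ e'∈N) o)
      e'∈N (inj₂ o) → _ , m , nonVarˡ⇒¬varBinding (λ ()) , inj₂ (arg (∈-zip⇒∈ʳ e'∈N) o)
  ; N-lighter   = weight-decompose {f = f} {g = f}
  }

delete-lowering : ∀ {S X} → (var X , var X) ∈ S → Lowering S (var X , var X) []
delete-lowering m = record
  { e∈S         = m
  ; ¬varBinding = λ { (_ , X≢X , refl) → X≢X refl }
  ; N-occurs    = λ ()
  ; N-lighter   = λ ()
  }

swap-lowering : ∀ {S t X} → (t , var X) ∈ S → NonVar t → Lowering S (t , var X) [ (var X , t) ]
swap-lowering m nonVar = record
  { e∈S         = m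
  ; ¬varBinding = nonVarˡ⇒¬varBinding nonVar
  ; N-occurs    = λ where
      (here refl) (inj₁ o) → _ , m , nonVarˡ⇒¬varBinding nonVar , inj₂ o
      (here refl) (inj₂ o) → _ , m , nonVarˡ⇒¬varBinding nonVar , inj₁ o
  ; N-lighter   = λ { (here refl) → weight-swap nonVar }
  }

merge-lowering : ∀ {S X t u} → (var X , t) ∈ S → (var X , u) ∈ S →
                 NonVar t → NonVar u → size t ≤ size u →
                 Lowering S (var X , u) [ (t , u) ]
merge-lowering mt mu nonVar-t nonVar-u t≤u = record
  { e∈S         = mu
  ; ¬varBinding = nonVarʳ⇒¬varBinding nonVar-u
  ; N-occurs    = λ where
      (here refl) (inj₁ o) → _ , mt , nonVarʳ⇒¬varBinding nonVar-t , inj₂ o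
      (here refl) (inj₂ o) → _ , mu , nonVarʳ⇒¬varBinding nonVar-u , inj₂ o
  ; N-lighter   = λ { (here refl) → weight-merge nonVar-t nonVar-u t≤u }
  }

module Elimination {S S' X Y} (m : (var X , var Y) ∈ S) (X≢Y : X ≢ Y)
  (elsewhere : OccursElsewhere X (var X , var Y) S)
  (SO : SubstOthers S (var X , var Y) [ X ↦ var Y ] S') where

  occurs : ∀ {x} → OccursIn x S' → OccursIn x S
  occurs (e' , e'∈ , o) with proj₁ (SO e') e'∈
  ... | inj₁ refl                  = _ , m , o
  ... | inj₂ (e , e∈S , _ , refl) with occEq-[↦var] e o
  ...   | inj₁ refl       = _ , m , inj₂ here
  ...   | inj₂ (o' , _)   = e , e∈S , o'

  X-not-isolated : ¬ Isolated S X
  X-not-isolated (e , _ , _ , only) =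
    let e' , e'∈S , e'≢ , o = elsewhere in e'≢ (trans (only e'∈S o) (sym (only m (inj₁ here))))

  X-isolated : Isolated S' X
  X-isolated = _ , proj₂ (SO _) (inj₁ refl) , (Y , X≢Y , refl) , only
    where
      only : ∀ {e'} → e' ∈ S' → OccEq X e' → e' ≡ (var X , var Y)
      only {e'} e'∈ o with proj₁ (SO e') e'∈
      ... | inj₁ e'≡               = e'≡
      ... | inj₂ (e , _ , _ , refl) with occEq-[↦var] e o
      ...   | inj₁ X≡Y       = ⊥-elim (X≢Y X≡Y)
      ...   | inj₂ (_ , X≢X) = ⊥-elim (X≢X refl)

  isolated : ∀ {Z} → Isolated S Z → Isolated S' Z
  isolated {Z} iso@(_ , eZ∈S , (W , Z≢W , refl) , only) with [↦var]-var X Y W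
  ... | W' , σW≡W' , W'-cases = _ , eZ'∈S' , (W' , Z≢W' , cong₂ _,_ σZ≡Z σW≡W') , only'
    where
      Z≢X : Z ≢ X
      Z≢X refl = X-not-isolated iso
      Y≢Z : Y ≢ Z
      Y≢Z refl = Z≢X (sym (var-injective (cong proj₁ (only m (inj₂ here)))))
      σZ≡Z : [ X ↦ var Y ] Z ≡ var Z
      σZ≡Z = [↦]-≢ (var Y) (Z≢X ∘ sym)
      Z≢W' : Z ≢ W'
      Z≢W' Z≡W' = Sum.[ (λ W'≡Y → Y≢Z (sym (trans Z≡W' W'≡Y)))
                      , (λ (W'≡W , _) → Z≢W (trans Z≡W' W'≡W)) ] W'-cases
      eZ'∈S' : [ X ↦ var Y ] ·ₑ (var Z , var W) ∈ S'
      eZ'∈S' = proj₂ (SO _) (inj₂ (_ , eZ∈S , Z≢X ∘ var-injective ∘ cong proj₁ , refl))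
      only' : ∀ {e'} → e' ∈ S' → OccEq Z e' → e' ≡ [ X ↦ var Y ] ·ₑ (var Z , var W)
      only' {e'} e'∈ o with proj₁ (SO e') e'∈
      ... | inj₁ refl = ⊥-elim (Sum.[ Z≢X ∘ occ-var , Y≢Z ∘ sym ∘ occ-var ] o)
      ... | inj₂ (e , e∈S , _ , refl) with occEq-[↦var] e o
      ...   | inj₁ Z≡Y      = ⊥-elim (Y≢Z (sym Z≡Y))
      ...   | inj₂ (o' , _) = cong ([ X ↦ var Y ] ·ₑ_) (only e∈S o')

  weightBound : ∀ {K} → WeightBound K S → WeightBound K S'
  weightBound {K} bound {e'} e'∈ with proj₁ (SO e') e'∈
  ... | inj₁ refl                 = bound m
  ... | inj₂ (e , e∈S , _ , refl) = subst (_< K) (sym (renaming-weight [↦var]-renaming e)) (bound e∈S)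

  decreases : ∀ {K} → measure K S' ≺ measure K S
  decreases = this (countDistinct-< _≟_ (nonIsolated-⊆ occurs isolated) X∈ X∉) refl
    where
      X∈ : X ∈ nonIsolated S
      X∈ = ∈-filter⁺ (¬? ∘ isolated? S) (occursIn⇒∈vars (_ , m , inj₁ here)) X-not-isolated
      X∉ : X ∉ nonIsolated S'
      X∉ X∈' = proj₂ (∈-filter⁻ (¬? ∘ isolated? S') {xs = vars S'} X∈') X-isolated

lowering-decreases : ∀ {K S e N S'} → Lowering S e N → Replaces S e N S' → WeightBound K S →
                     WeightBound K S' × measure K S' ≺ measure K S
lowering-decreases L R bound = LoweringStep.weightBound L R bound , LoweringStep.decreases L R bound

minusStep-decreases : ∀ {K S S'} → MinusStep S (eqs S') → WeightBound K S →
                      WeightBound K S' × measure K S' ≺ measure K S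
minusStep-decreases (common (decompose m _ R))      = lowering-decreases (decompose-lowering m) R
minusStep-decreases (common (delete m R))           = lowering-decreases (delete-lowering m) R
minusStep-decreases (common (swap m nonVar R))      = lowering-decreases (swap-lowering m nonVar) R
minusStep-decreases (merge mt mu _ nt nu t≤u R)     =
  lowering-decreases (merge-lowering mt mu nt nu t≤u) R
minusStep-decreases (elimVar m X≢Y elsewhere SO) bound =
  Elimination.weightBound m X≢Y elsewhere SO bound , Elimination.decreases m X≢Y elsewhere SO

no-infinite-minusSteps : ∀ {K} (S : ℕ → Eqs) → WeightBound K (S 0) →
                         ¬ (∀ n → MinusStep (S n) (eqs (S (suc n))))
no-infinite-minusSteps {K} S bound₀ steps =
  acc⇒no-descent (measure K ∘ S) (≺-wellFounded _) λ n → proj₂ (minusStep-decreases (steps n) (bound n))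
  where
    bound : ∀ n → WeightBound K (S n)
    bound zero    = bound₀
    bound (suc n) = proj₁ (minusStep-decreases (steps n) (bound n))

⟶⁻-source : ∀ {s s'} → s ⟶⁻ s' → ∃ λ S → s ≡ eqs S
⟶⁻-source (step _) = _ , refl

infiniteRun⇒minusSteps : ∀ {f : ℕ → State} → (∀ n → f n ⟶⁻ f (suc n)) →
  ∃ λ (S : ℕ → Eqs) → (∀ n → f n ≡ eqs (S n)) × (∀ n → MinusStep (S n) (eqs (S (suc n))))
infiniteRun⇒minusSteps {f} run = S , f≡ , steps
  where
    S : ℕ → Eqs
    S n = proj₁ (⟶⁻-source (run n))
    f≡ : ∀ n → f n ≡ eqs (S n)
    f≡ n = proj₂ (⟶⁻-source (run n))
    steps : ∀ n → MinusStep (S n) (eqs (S (suc n)))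
    steps n with subst₂ _⟶⁻_ (f≡ n) (f≡ (suc n)) (run n)
    ... | step st = st

eqs-injective : ∀ {E E'} → eqs E ≡ eqs E' → E ≡ E'
eqs-injective refl = refl

minus-terminates : ∀ E → ¬ ∃ λ (f : ℕ → State) → f 0 ≡ eqs E × (∀ n → f n ⟶⁻ f (suc n))
minus-terminates E (f , f₀ , run) =
  let S , f≡ , steps = infiniteRun⇒minusSteps run
      S₀≡E = eqs-injective (trans (sym (f≡ 0)) f₀)
  in no-infinite-minusSteps S (subst (WeightBound _) (sym S₀≡E) (initialWeightBound E)) steps

wnsto⇒MMA⁻Sound : ∀ E → WNSTO E → MMA⁻Sound E
wnsto⇒MMA⁻Sound E wnsto = minus-terminates E , minus-correct wnsto

corollary12 : (R : SelectionRule) (P : Program) (Q : Query) →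
    WeaklyOccurCheckFree P R Q →
    ∀ A H → Available P R Q A H → MMA⁻Sound (UnifEqs A H)
corollary12 R P Q weaklyOccurCheckFree A H available =
  wnsto⇒MMA⁻Sound (UnifEqs A H) (weaklyOccurCheckFree A H available)
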